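{- Let $s$ be a positive integer, $l=s^2$, $P=\mathbf{s}^2$ and $Q=\mathbf{l}^2$. If $f,g:P\to Q$ are two casual embeddings, then $f(P)=g(P)$, and $f\circ g^{ -1}$ and $g\circ f^{ -1}$ (with $g^{ -1}$, $f^{ -1}$ defined on this common image) are automorphisms of $P$.
   Context: $\mathbf{k}$ denotes the $k$-element chain, and $\mathbf{k}^t$ the product poset on $[k]^t$ ordered coordinatewise. For $x\in\mathbf{l}^t$ and $1\le i\le t$, $\mathrm{Proj}_i(x)$ is the $i$th coordinate of $x$ (its position in $\mathbf{l}$). An embedding $f:P\to Q$ is a map with $x\le y$ in $P$ iff $f(x)\le f(y)$ in $Q$. With $l=s^t$, an embedding $f:\mathbf{s}^t\to\mathbf{l}^t$ is casual if for all $i,j$ with $1\le i\le t$ and $1\le j\le l$ there is exactly one $x\in\mathbf{s}^t$ with $\mathrm{Proj}_i(f(x))=j$. -}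

module Defs where

open import Data.Nat using (ℕ; _^_)
open import Data.Fin using (Fin)
import Data.Fin as F
open import Data.Vec using (Vec; lookup)
open import Data.Vec.Relation.Binary.Pointwise.Inductive using (Pointwise)
open import Data.Product using (Σ; _×_; ∃)
open import Relation.Binary.PropositionalEquality using (_≡_)
open import Function.Definitions using (Bijective)

-- The product poset k^t : points are t-tuples over the k-element chain
-- (Fin k, with coordinates indexed by Fin t), ordered coordinatewise.
Pt : ℕ → ℕ → Set
Pt k t = Vec (Fin k) t

_≼_ : ∀ {k t} → Pt k t → Pt k t → Set
_≼_ = Pointwise F._≤_

Proj : ∀ {k t} → Fin t → Pt k t → Fin k
Proj i x = lookup x i

IsEmbedding : ∀ {a b t} → (Pt a t → Pt b t) → Set
IsEmbedding f = ∀ x y → ((x ≼ y → f x ≼ f y) × (f x ≼ f y → x ≼ y))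

ExactlyOne : ∀ {A : Set} → (A → Set) → Set
ExactlyOne {A} P = Σ A (λ x → P x × (∀ y → P y → y ≡ x))

IsCasual : (s t : ℕ) → (Pt s t → Pt (s ^ t) t) → Set
IsCasual s t f =
  IsEmbedding f ×
  (∀ (i : Fin t) (j : Fin (s ^ t)) → ExactlyOne (λ x → Proj i (f x) ≡ j))

IsAutomorphism : ∀ {k t} → (Pt k t → Pt k t) → Set
IsAutomorphism h = IsEmbedding h × Bijective _≡_ _≡_ h

{-# OPTIONS --safe #-}
-- The two coordinates of a casual embedding f are linear extensions of P (monotone bijections
-- onto the chain 𝐥, as l = |P|) and form a realizer: x ≤ y iff both coordinates say so.
-- For a pair u north-west of v the two coordinates must order u and v oppositely, and raising
-- points shows that the coordinate ordering the corners (0,1) and (1,0) as u before v does so for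
-- every north-west pair. Such a linear extension is strictly increasing for the lexicographic
-- order, hence unique; the other coordinate is that one precomposed with the transposition.
-- So f and g agree up to the identity or the transposition of P, both automorphisms.
module Submission where

open import Defs
open import Data.Nat using (ℕ; _≤_; _^_)
open import Data.Product using (Σ; _×_; ∃)
open import Relation.Binary.PropositionalEquality using (_≡_)

open import Algebra.Definitions using (Involutive)
import Data.Nat as ℕ
import Data.Nat.Properties as ℕ
open import Data.Fin as Fin using (Fin; zero; suc; toℕ; inject₁; opposite)
import Data.Fin.Properties as Fin
open import Data.Empty using (⊥-elim)
open import Data.Product using (_,_; proj₁; proj₂)
open import Data.Sum as Sum using (_⊎_; inj₁; inj₂)
open import Data.Vec using (_∷_; [])
open import Data.Vec.Relation.Binary.Pointwise.Inductive as Pointwise using (_∷_; [])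
open import Data.Vec.Relation.Binary.Pointwise.Extensional using (ext; extensional⇒inductive)
open import Function using (_∘_; id)
open import Function.Definitions using (Injective; StrictlySurjective)
open import Function.Consequences.Propositional using (strictlySurjective⇒surjective)
open import Relation.Binary.Core using (_Preserves_⟶_)
open import Relation.Binary.Definitions using (tri<; tri≈; tri>)
open import Relation.Binary.PropositionalEquality
  using (_≢_; refl; sym; trans; cong; subst; subst₂; module ≡-Reasoning)
open import Relation.Nullary using (¬_; yes; no)

private
  variable
    k m n s t : ℕ

inject₁-mono-< : {i j : Fin n} → i Fin.< j → inject₁ i Fin.< inject₁ j
inject₁-mono-< {i = i} {j} = subst₂ ℕ._<_ (sym (Fin.toℕ-inject₁ i)) (sym (Fin.toℕ-inject₁ j))

opposite-anti-< : {i j : Fin n} → i Fin.< j → opposite j Fin.< opposite i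
opposite-anti-< {i = i} {j} i<j =
  subst₂ ℕ._<_ (sym (Fin.opposite-prop j)) (sym (Fin.opposite-prop i))
    (ℕ.∸-monoʳ-< (ℕ.s<s i<j) (Fin.toℕ<n j))

increasing⇒toℕ≤ : {f : Fin n → Fin m} → f Preserves Fin._<_ ⟶ Fin._<_ →
                  ∀ i → toℕ i ℕ.≤ toℕ (f i)
increasing⇒toℕ≤ inc zero = ℕ.z≤n
increasing⇒toℕ≤ {f = f} inc (suc i) =
  ℕ.≤-trans (ℕ.s≤s (increasing⇒toℕ≤ {f = f ∘ inject₁} (inc ∘ inject₁-mono-<) i))
            (inc (Fin.≤̄⇒inject₁< Fin.≤-refl))

-- Conjugating by opposite turns the lower bound of increasing⇒toℕ≤ into an upper bound.
increasing-endo≗id : {f : Fin n → Fin n} → f Preserves Fin._<_ ⟶ Fin._<_ → ∀ i → f i ≡ i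
increasing-endo≗id {f = f} inc i = Fin.≤-antisym (ℕ.≮⇒≥ i≮fi) (increasing⇒toℕ≤ inc i)
  where
    reversed : toℕ (opposite i) ℕ.≤ toℕ (opposite (f i))
    reversed = subst (λ j → toℕ (opposite i) ℕ.≤ toℕ (opposite (f j))) (Fin.opposite-involutive i)
      (increasing⇒toℕ≤ {f = opposite ∘ f ∘ opposite} (opposite-anti-< ∘ inc ∘ opposite-anti-<) (opposite i))
    i≮fi : ¬ i Fin.< f i
    i≮fi i<fi = ℕ.<⇒≱ (opposite-anti-< i<fi) reversed

module _ {A : Set} {_⊏_ : A → A → Set} (compare : ∀ x y → x ⊏ y ⊎ x ≡ y ⊎ y ⊏ x) where

  increasing⇒injective : {L : A → Fin n} → L Preserves _⊏_ ⟶ Fin._<_ → Injective _≡_ _≡_ L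
  increasing⇒injective inc {x} {y} Lx≡Ly with compare x y
  ... | inj₁ x⊏y        = ⊥-elim (Fin.<⇒≢ (inc x⊏y) Lx≡Ly)
  ... | inj₂ (inj₁ x≡y) = x≡y
  ... | inj₂ (inj₂ y⊏x) = ⊥-elim (Fin.<⇒≢ (inc y⊏x) (sym Lx≡Ly))

  increasing⇒reflects-< : {L : A → Fin n} → L Preserves _⊏_ ⟶ Fin._<_ →
                          ∀ {x y} → L x Fin.< L y → x ⊏ y
  increasing⇒reflects-< inc {x} {y} Lx<Ly with compare x y
  ... | inj₁ x⊏y         = x⊏y
  ... | inj₂ (inj₁ refl) = ⊥-elim (Fin.<-irrefl refl Lx<Ly)
  ... | inj₂ (inj₂ y⊏x)  = ⊥-elim (Fin.<-asym Lx<Ly (inc y⊏x))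

  increasing-surjection-unique : {L K : A → Fin n} →
    L Preserves _⊏_ ⟶ Fin._<_ → StrictlySurjective _≡_ L → K Preserves _⊏_ ⟶ Fin._<_ →
    ∀ x → K x ≡ L x
  increasing-surjection-unique {L = L} {K} incL surL incK x = begin
    K x              ≡⟨ cong K (sym L⁻¹∘L) ⟩
    K (L⁻¹ (L x))    ≡⟨ increasing-endo≗id K∘L⁻¹-increasing (L x) ⟩
    L x              ∎
    where
      open ≡-Reasoning
      L⁻¹ : Fin _ → A
      L⁻¹ j = proj₁ (surL j)
      L∘L⁻¹ : ∀ j → L (L⁻¹ j) ≡ j
      L∘L⁻¹ j = proj₂ (surL j)
      L⁻¹∘L : L⁻¹ (L x) ≡ x
      L⁻¹∘L = increasing⇒injective incL (L∘L⁻¹ (L x))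
      K∘L⁻¹-increasing : (K ∘ L⁻¹) Preserves Fin._<_ ⟶ Fin._<_
      K∘L⁻¹-increasing i<j =
        incK (increasing⇒reflects-< incL (subst₂ Fin._<_ (sym (L∘L⁻¹ _)) (sym (L∘L⁻¹ _)) i<j))

involution-shift : {A B : Set} {h : A → A} {F G : A → B} → Involutive _≡_ h →
                   (∀ x → F (h x) ≡ G x) → ∀ x → F x ≡ G (h x)
involution-shift {F = F} h-involutive F∘h≗G x =
  trans (cong F (sym (h-involutive x))) (F∘h≗G _)

involution-cancel : {A B : Set} {h : A → A} {F G : A → B} → Involutive _≡_ h →
                    (∀ x → F (h x) ≡ G (h x)) → ∀ x → F x ≡ G x
involution-cancel {h = h} {F} {G} h-involutive F∘h≗G∘h x =
  trans (involution-shift {F = F} {G ∘ h} h-involutive F∘h≗G∘h x) (cong G (h-involutive x))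

≡-fromProj : {u v : Pt n t} → (∀ i → Proj i u ≡ Proj i v) → u ≡ v
≡-fromProj u≗v = Pointwise.Pointwise-≡⇒≡ (extensional⇒inductive (ext u≗v))

≗-fromProj₂ : {A : Set} {F G : A → Pt n 2} → (∀ x → Proj zero (F x) ≡ Proj zero (G x)) →
              (∀ x → Proj (suc zero) (F x) ≡ Proj (suc zero) (G x)) → ∀ x → F x ≡ G x
≗-fromProj₂ p q x = ≡-fromProj λ { zero → p x ; (suc zero) → q x }

≼-fromProj : {u v : Pt n t} → (∀ i → Proj i u Fin.≤ Proj i v) → u ≼ v
≼-fromProj u≤v = extensional⇒inductive (ext u≤v)

monotone-involution⇒automorphism : {h : Pt k t → Pt k t} →
  h Preserves _≼_ ⟶ _≼_ → Involutive _≡_ h → IsAutomorphism h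
monotone-involution⇒automorphism {h = h} mono inv =
  (λ x y → mono , λ hx≼hy → subst₂ _≼_ (inv x) (inv y) (mono hx≼hy)) ,
  (λ {x} {y} hx≡hy → trans (sym (inv x)) (trans (cong h hx≡hy) (inv y))) ,
  strictlySurjective⇒surjective (λ y → h y , inv y)

transpose : Pt s 2 → Pt s 2
transpose (a ∷ b ∷ []) = b ∷ a ∷ []

transpose-involutive : Involutive _≡_ (transpose {s})
transpose-involutive (a ∷ b ∷ []) = refl

transpose-mono : transpose Preserves _≼_ ⟶ _≼_ {s}
transpose-mono (a≤c ∷ b≤d ∷ []) = b≤d ∷ a≤c ∷ []

transpose-automorphism : IsAutomorphism (transpose {s})
transpose-automorphism = monotone-involution⇒automorphism transpose-mono transpose-involutive

id-automorphism : IsAutomorphism {k} {t} id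
id-automorphism = monotone-involution⇒automorphism id (λ _ → refl)

-- u is north-west of v: the incomparable pairs of P, each listed once.
NW : Pt s 2 → Pt s 2 → Set
NW (a ∷ b ∷ []) (c ∷ d ∷ []) = a Fin.< c × d Fin.< b

NW⇒⋠ : {u v : Pt s 2} → NW u v → ¬ u ≼ v
NW⇒⋠ {u = _ ∷ _ ∷ []} {_ ∷ _ ∷ []} (_ , d<b) (_ ∷ b≤d ∷ []) = ℕ.<⇒≱ d<b b≤d

NW⇒⋡ : {u v : Pt s 2} → NW u v → ¬ v ≼ u
NW⇒⋡ {u = _ ∷ _ ∷ []} {_ ∷ _ ∷ []} (a<c , _) (c≤a ∷ _ ∷ []) = ℕ.<⇒≱ a<c c≤a

NW-transpose : {u v : Pt s 2} → NW u v → NW (transpose v) (transpose u)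
NW-transpose {u = _ ∷ _ ∷ []} {_ ∷ _ ∷ []} (a<c , d<b) = d<b , a<c

_⊏_ : Pt s 2 → Pt s 2 → Set
(a ∷ b ∷ []) ⊏ (c ∷ d ∷ []) = a Fin.< c ⊎ (a ≡ c × b Fin.< d)

⊏-compare : (x y : Pt s 2) → x ⊏ y ⊎ x ≡ y ⊎ y ⊏ x
⊏-compare (a ∷ b ∷ []) (c ∷ d ∷ []) with Fin.<-cmp a c
... | tri< a<c _ _ = inj₁ (inj₁ a<c)
... | tri> _ _ c<a = inj₂ (inj₂ (inj₁ c<a))
... | tri≈ _ refl _ with Fin.<-cmp b d
...   | tri< b<d _ _  = inj₁ (inj₂ (refl , b<d))
...   | tri≈ _ refl _ = inj₂ (inj₁ refl)
...   | tri> _ _ d<b  = inj₂ (inj₂ (inj₂ (refl , d<b)))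

record IsLinearExtension (L : Pt k t → Fin n) : Set where
  field
    monotone   : L Preserves _≼_ ⟶ Fin._≤_
    injective  : Injective _≡_ _≡_ L
    surjective : StrictlySurjective _≡_ L

  strictlyMonotone : ∀ {x y} → x ≼ y → x ≢ y → L x Fin.< L y
  strictlyMonotone x≼y x≢y = Fin.≤∧≢⇒< (monotone x≼y) (x≢y ∘ injective)

open IsLinearExtension

linearExtension-∘-automorphism : {L : Pt k t → Fin n} {h : Pt k t → Pt k t} →
  IsAutomorphism h → IsLinearExtension L → IsLinearExtension (L ∘ h)
linearExtension-∘-automorphism {L = L} (embedding , h-injective , h-surjective) ext-L = record
  { monotone   = λ {x} {y} x≼y → monotone ext-L (proj₁ (embedding x y) x≼y)
  ; injective  = h-injective ∘ injective ext-L
  ; surjective = λ j → let y , Ly≡j = surjective ext-L j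
                           x , hx≡y = h-surjective y
                       in x , trans (cong L (hx≡y refl)) Ly≡j
  }

RespectsNW : (Pt s 2 → Fin n) → Set
RespectsNW L = ∀ {u v} → NW u v → L u Fin.< L v

IsLexExtension : (Pt s 2 → Fin n) → Set
IsLexExtension L = L Preserves _⊏_ ⟶ Fin._<_ × StrictlySurjective _≡_ L

linearExtension-respectsNW⇒lexExtension : {L : Pt s 2 → Fin n} →
  IsLinearExtension L → RespectsNW L → IsLexExtension L
linearExtension-respectsNW⇒lexExtension {L = L} ext-L respectsNW = increasing , surjective ext-L
  where
    increasing : L Preserves _⊏_ ⟶ Fin._<_
    increasing {a ∷ b ∷ []} {c ∷ d ∷ []} (inj₁ a<c) with b Fin.≤? d
    ... | yes b≤d = strictlyMonotone ext-L (ℕ.<⇒≤ a<c ∷ b≤d ∷ []) λ { refl → Fin.<-irrefl refl a<c }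
    ... | no  b≰d = respectsNW (a<c , ℕ.≰⇒> b≰d)
    increasing {a ∷ b ∷ []} {c ∷ d ∷ []} (inj₂ (refl , b<d)) =
      strictlyMonotone ext-L (Fin.≤-refl ∷ ℕ.<⇒≤ b<d ∷ []) λ { refl → Fin.<-irrefl refl b<d }

lexExtension-unique : {L K : Pt s 2 → Fin n} → IsLexExtension L → IsLexExtension K → ∀ x → L x ≡ K x
lexExtension-unique (incL , _) (incK , surK) = increasing-surjection-unique ⊏-compare incK surK incL

record IsRealizer (L L′ : Pt k t → Fin n) : Set where
  field
    monotoneˡ : L Preserves _≼_ ⟶ Fin._≤_
    monotoneʳ : L′ Preserves _≼_ ⟶ Fin._≤_
    reflects  : ∀ {x y} → L x Fin.≤ L y → L′ x Fin.≤ L′ y → x ≼ y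

open IsRealizer

realizer-swap : {L L′ : Pt k t → Fin n} → IsRealizer L L′ → IsRealizer L′ L
realizer-swap r = record
  { monotoneˡ = monotoneʳ r ; monotoneʳ = monotoneˡ r ; reflects = λ p q → reflects r q p }

realizer-reverses : {L L′ : Pt k t → Fin n} → IsRealizer L L′ →
                    ∀ {x y} → ¬ x ≼ y → L x Fin.≤ L y → L′ y Fin.< L′ x
realizer-reverses r x⋠y Lx≤Ly = ℕ.≰⇒> (x⋠y ∘ reflects r Lx≤Ly)

realizer-raise : {L L′ : Pt k t → Fin n} → IsRealizer L L′ →
                 ∀ {u u′ v} → ¬ u ≼ v → ¬ v ≼ u′ → u ≼ u′ → L u Fin.< L v → L u′ Fin.< L v
realizer-raise r u⋠v v⋠u′ u≼u′ Lu<Lv =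
  realizer-reverses (realizer-swap r) v⋠u′
    (ℕ.<⇒≤ (ℕ.<-≤-trans (realizer-reverses r u⋠v (ℕ.<⇒≤ Lu<Lv)) (monotoneʳ r u≼u′)))

p₀₁ p₁₀ : Pt (2 ℕ.+ k) 2
p₀₁ = zero ∷ suc zero ∷ []
p₁₀ = suc zero ∷ zero ∷ []

p₀₁-NW-p₁₀ : NW (p₀₁ {k}) p₁₀
p₀₁-NW-p₁₀ = ℕ.z<s , ℕ.z<s

-- Every NW pair (a,b),(c,d) is reached from (0,1),(1,0) by raising (0,1) to (0,b),
-- then (1,0) to (c,d), then (0,b) to (a,b).
realizer-respectsNW : {L L′ : Pt (2 ℕ.+ k) 2 → Fin n} → IsRealizer L L′ →
                      L p₀₁ Fin.< L p₁₀ → RespectsNW L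
realizer-respectsNW {k} {L = L} r corner {a ∷ b ∷ []} {c ∷ d ∷ []} (a<c , d<b) =
  realizer-raise r (NW⇒⋠ (0<c , d<b)) (NW⇒⋡ (a<c , d<b)) (ℕ.z≤n ∷ ℕ.≤-refl ∷ [])
    (ℕ.<-≤-trans [0,b]<p₁₀ (monotoneˡ r (0<c ∷ ℕ.z≤n ∷ [])))
  where
    0<b : 0 ℕ.< toℕ b
    0<b = ℕ.≤-trans (ℕ.s≤s ℕ.z≤n) d<b
    0<c : 0 ℕ.< toℕ c
    0<c = ℕ.≤-trans (ℕ.s≤s ℕ.z≤n) a<c
    [0,b]<p₁₀ : L (zero ∷ b ∷ []) Fin.< L p₁₀
    [0,b]<p₁₀ = realizer-raise r (NW⇒⋠ (p₀₁-NW-p₁₀ {k})) (NW⇒⋡ (ℕ.z<s , 0<b)) (ℕ.z≤n ∷ 0<b ∷ []) corner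

realizer-orientation : {L L′ : Pt s 2 → Fin n} → IsRealizer L L′ → RespectsNW L ⊎ RespectsNW L′
realizer-orientation {s = 0} _ = inj₁ λ { {() ∷ _} }
realizer-orientation {s = 1} _ = inj₁ λ { {zero ∷ _ ∷ []} {zero ∷ _ ∷ []} (() , _) }
realizer-orientation {s = ℕ.suc (ℕ.suc k)} {L = L} r with L p₀₁ Fin.<? L p₁₀
... | yes corner = inj₁ (realizer-respectsNW r corner)
... | no  corner̸ = inj₂ (realizer-respectsNW (realizer-swap r)
                          (realizer-reverses r (NW⇒⋡ (p₀₁-NW-p₁₀ {k})) (ℕ.≮⇒≥ corner̸)))

realizer-respectsNW-transpose : {L L′ : Pt s 2 → Fin n} → IsRealizer L L′ →
                                RespectsNW L → RespectsNW (L′ ∘ transpose)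
realizer-respectsNW-transpose r respectsNW u-NW-v =
  realizer-reverses r (NW⇒⋠ (NW-transpose u-NW-v)) (ℕ.<⇒≤ (respectsNW (NW-transpose u-NW-v)))

casual-coordinate : {f : Pt s t → Pt (s ^ t) t} → IsCasual s t f → ∀ i → IsLinearExtension (Proj i ∘ f)
casual-coordinate {f = f} (embedding , exactlyOne) i = record
  { monotone   = λ {x} {y} x≼y → Pointwise.lookup (proj₁ (embedding x y) x≼y) i
  ; injective  = injective′
  ; surjective = λ j → let x , fx≡j , _ = exactlyOne i j in x , fx≡j
  }
  where
    injective′ : Injective _≡_ _≡_ (Proj i ∘ f)
    injective′ {x} {y} fx≡fy =
      let _ , _ , only = exactlyOne i (Proj i (f y)) in trans (only x fx≡fy) (sym (only y refl))

casual-realizer : {f : Pt s 2 → Pt (s ^ 2) 2} → IsCasual s 2 f →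
                  IsRealizer (Proj zero ∘ f) (Proj (suc zero) ∘ f)
casual-realizer c@(embedding , _) = record
  { monotoneˡ = monotone (casual-coordinate c zero)
  ; monotoneʳ = monotone (casual-coordinate c (suc zero))
  ; reflects  = λ {x} {y} p q → proj₂ (embedding x y) (≼-fromProj λ { zero → p ; (suc zero) → q })
  }

casual-orientation : {f : Pt s 2 → Pt (s ^ 2) 2} → IsCasual s 2 f →
  (IsLexExtension (Proj zero ∘ f) × IsLexExtension (Proj (suc zero) ∘ f ∘ transpose)) ⊎
  (IsLexExtension (Proj zero ∘ f ∘ transpose) × IsLexExtension (Proj (suc zero) ∘ f))
casual-orientation {f = f} c = Sum.map first-respectsNW second-respectsNW (realizer-orientation r)
  where
    r : IsRealizer (Proj zero ∘ f) (Proj (suc zero) ∘ f)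
    r = casual-realizer c
    lex : ∀ i → RespectsNW (Proj i ∘ f) → IsLexExtension (Proj i ∘ f)
    lex i = linearExtension-respectsNW⇒lexExtension (casual-coordinate c i)
    lexᵀ : ∀ i → RespectsNW (Proj i ∘ f ∘ transpose) → IsLexExtension (Proj i ∘ f ∘ transpose)
    lexᵀ i = linearExtension-respectsNW⇒lexExtension
               (linearExtension-∘-automorphism transpose-automorphism (casual-coordinate c i))
    first-respectsNW : RespectsNW (Proj zero ∘ f) →
      IsLexExtension (Proj zero ∘ f) × IsLexExtension (Proj (suc zero) ∘ f ∘ transpose)
    first-respectsNW nw = lex zero nw , lexᵀ (suc zero) (realizer-respectsNW-transpose r nw)
    second-respectsNW : RespectsNW (Proj (suc zero) ∘ f) →
      IsLexExtension (Proj zero ∘ f ∘ transpose) × IsLexExtension (Proj (suc zero) ∘ f)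
    second-respectsNW nw = lexᵀ zero (realizer-respectsNW-transpose (realizer-swap r) nw) , lex (suc zero) nw

casual-unique-up-to-transpose : {f g : Pt s 2 → Pt (s ^ 2) 2} → IsCasual s 2 f → IsCasual s 2 g →
  (∀ x → f x ≡ g x) ⊎ (∀ x → f x ≡ g (transpose x))
casual-unique-up-to-transpose cf cg with casual-orientation cf | casual-orientation cg
... | inj₁ (f₀ , f₁ᵀ) | inj₁ (g₀ , g₁ᵀ) =
  inj₁ (≗-fromProj₂ (lexExtension-unique f₀ g₀)
                    (involution-cancel transpose-involutive (lexExtension-unique f₁ᵀ g₁ᵀ)))
... | inj₁ (f₀ , f₁ᵀ) | inj₂ (g₀ᵀ , g₁) =
  inj₂ (≗-fromProj₂ (lexExtension-unique f₀ g₀ᵀ)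
                    (involution-shift transpose-involutive (lexExtension-unique f₁ᵀ g₁)))
... | inj₂ (f₀ᵀ , f₁) | inj₁ (g₀ , g₁ᵀ) =
  inj₂ (≗-fromProj₂ (involution-shift transpose-involutive (lexExtension-unique f₀ᵀ g₀))
                    (lexExtension-unique f₁ g₁ᵀ))
... | inj₂ (f₀ᵀ , f₁) | inj₂ (g₀ᵀ , g₁) =
  inj₁ (≗-fromProj₂ (involution-cancel transpose-involutive (lexExtension-unique f₀ᵀ g₀ᵀ))
                    (lexExtension-unique f₁ g₁))

casual-related-by-involutive-automorphism : {f g : Pt s 2 → Pt (s ^ 2) 2} →
  IsCasual s 2 f → IsCasual s 2 g →
  ∃ λ h → IsAutomorphism h × Involutive _≡_ h × (∀ x → f x ≡ g (h x))
casual-related-by-involutive-automorphism cf cg with casual-unique-up-to-transpose cf cg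
... | inj₁ f≗g   = id , id-automorphism , (λ _ → refl) , f≗g
... | inj₂ f≗g∘T = transpose , transpose-automorphism , transpose-involutive , f≗g∘T

lemma6p4 : (s : ℕ) → 1 ≤ s →
    (f g : Pt s 2 → Pt (s ^ 2) 2) → IsCasual s 2 f → IsCasual s 2 g →
    -- f(P) = g(P)
    ((∀ x → ∃ λ y → f x ≡ g y) × (∀ y → ∃ λ x → g y ≡ f x)) ×
    -- g⁻¹ ∘ f (i.e. the unique h with g ∘ h = f) is an automorphism of P
    (Σ (Pt s 2 → Pt s 2) λ h → (∀ x → g (h x) ≡ f x) × IsAutomorphism h) ×
    -- f⁻¹ ∘ g (i.e. the unique h with f ∘ h = g) is an automorphism of P
    (Σ (Pt s 2 → Pt s 2) λ h → (∀ x → f (h x) ≡ g x) × IsAutomorphism h)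
lemma6p4 s _ f g cf cg with casual-related-by-involutive-automorphism cf cg
... | h , h-automorphism , h-involutive , f≗g∘h =
  ((λ x → h x , f≗g∘h x) , (λ y → h y , g≗f∘h y)) ,
  (h , (λ x → sym (f≗g∘h x)) , h-automorphism) ,
  (h , (λ x → sym (g≗f∘h x)) , h-automorphism)
  where
    g≗f∘h : ∀ y → g y ≡ f (h y)
    g≗f∘h = involution-shift h-involutive (λ y → sym (f≗g∘h y))
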